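{- Consider the buffer management problem with exactly two packet values $1$ and $\alpha>1$, with exactly one queue for each value and both queues of capacity $B$. Fix an input sequence, and let $b(t)$ and $b^*(t)$ denote the total number of packets stored in the queues of GREEDY and of a diligent optimal offline algorithm OPT, respectively, at time $t$. Then for every time $t$, $b^*(t)\le b(t)+B$.
   Context: Model: packets of value $1$ or $\alpha$ arrive over time (at non-integral times); each goes to the queue of its value, which holds at most $B$ packets, and is either admitted (only if there is room) or rejected. At the end of each unit time step (send event) at most one packet from a non-empty queue is transmitted. Benefit is the total value of transmitted packets. OPT is an offline algorithm maximizing the benefit, and it is diligent: it accepts every packet whose queue has room and sends a packet at every send event at which some queue is non-empty. GREEDY accepts every packet whose queue is not full and at each send event sends an $\alpha$-packet if available, otherwise a $1$-packet if available. Initially all queues are empty.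
   Formalization: The packet value α > 1 ranges over the rationals. -}

module Defs where

open import Data.Nat using (ℕ; zero; suc; _+_; _≤_; _<_; _<?_)
open import Relation.Nullary using (yes; no)
open import Data.List using (List; []; _∷_; take)
open import Data.Rational using (ℚ; _*_; _/_) renaming (_+_ to _+ℚ_; _≤_ to _≤ℚ_)
open import Data.Integer using (+_)
open import Relation.Binary.PropositionalEquality using (_≡_)

data Val : Set where
  one alpha : Val

-- An input sequence is a list of events in time order: packet arrivals
-- (at non-integral times) and send events (end of each unit time step).
data Event : Set where
  arrive : Val → Event
  send   : Event

data Decision : Set where
  accept reject : Decision
  sendFrom      : Val → Decision
  idle          : Decision

-- Configuration: queue contents (packets of equal value are
-- interchangeable, so counts suffice) and numbers of transmitted packets.
record State : Set where
  constructor st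
  field
    q1 qα : ℕ
    s1 sα : ℕ
open State public

s0 : State
s0 = st 0 0 0 0

size : Val → State → ℕ
size one   s = q1 s
size alpha s = qα s

buffer : State → ℕ
buffer s = q1 s + qα s

pred : ℕ → ℕ
pred zero = zero
pred (suc n) = n

step : State → Event → Decision → State
step (st a b c d) (arrive one)   accept         = st (suc a) b c d
step (st a b c d) (arrive alpha) accept         = st a (suc b) c d
step (st a b c d) send           (sendFrom one)   = st (pred a) b (suc c) d
step (st a b c d) send           (sendFrom alpha) = st a (pred b) c (suc d)
step s            _              _              = s

run : State → List Event → List Decision → State
run s (e ∷ es) (d ∷ ds) = run (step s e d) es ds
run s _        _        = s

data Legal (B : ℕ) (s : State) : Event → Decision → Set where
  acc : ∀ {v} → size v s < B → Legal B s (arrive v) accept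
  rej : ∀ {v} → Legal B s (arrive v) reject
  snd : ∀ {v} → 0 < size v s → Legal B s send (sendFrom v)
  idl : Legal B s send idle

data Valid (B : ℕ) : State → List Event → List Decision → Set where
  []  : ∀ {s} → Valid B s [] []
  _∷_ : ∀ {s e d es ds} → Legal B s e d → Valid B (step s e d) es ds →
        Valid B s (e ∷ es) (d ∷ ds)

data DiligentStep (B : ℕ) (s : State) : Event → Decision → Set where
  acc : ∀ {v} → size v s < B → DiligentStep B s (arrive v) accept
  rej : ∀ {v} → B ≤ size v s → DiligentStep B s (arrive v) reject
  snd : ∀ {v} → 0 < size v s → DiligentStep B s send (sendFrom v)
  idl : q1 s ≡ 0 → qα s ≡ 0 → DiligentStep B s send idle

data Diligent (B : ℕ) : State → List Event → List Decision → Set where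
  []  : ∀ {s} → Diligent B s [] []
  _∷_ : ∀ {s e d es ds} → DiligentStep B s e d → Diligent B (step s e d) es ds →
        Diligent B s (e ∷ es) (d ∷ ds)

greedyDec : ℕ → State → Event → Decision
greedyDec B s (arrive v) with size v s <? B
... | yes _ = accept
... | no  _ = reject
greedyDec B (st a (suc b) c d) send = sendFrom alpha
greedyDec B (st (suc a) zero c d) send = sendFrom one
greedyDec B (st zero zero c d) send = idle

greedy : ℕ → State → List Event → List Decision
greedy B s []       = []
greedy B s (e ∷ es) = greedyDec B s e ∷ greedy B (step s e (greedyDec B s e)) es

benefit : ℚ → State → ℚ
benefit α s = (+ s1 s / 1) +ℚ (α * (+ sα s / 1))

Optimal : ℚ → ℕ → List Event → List Decision → Set
Optimal α B evs ds = ∀ ds' → Valid B s0 evs ds' →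
  benefit α (run s0 evs ds') ≤ℚ benefit α (run s0 evs ds)

-- OPT stays within capacity, so it never stores more than 2B packets; GREEDY
-- rejects a packet only when one of its queues is full, i.e. when it stores at
-- least B packets; otherwise its buffer grows with OPT's. At a send event OPT,
-- being diligent, transmits whenever it stores anything while GREEDY loses at
-- most one packet. Hence b* ≤ b + B is preserved by every event.
module Submission where

open import Defs
open import Data.Nat using (ℕ; zero; suc; _+_; _≤_; _<_; z≤n; s≤s; s≤s⁻¹; _<?_)
open import Data.Nat.Properties
open import Data.List using (List; take)
open import Data.Rational using (ℚ; 1ℚ) renaming (_<_ to _<ℚ_)
open import Data.Sum using (_⊎_; inj₁; inj₂)
open import Relation.Nullary using (yes; no)
open import Relation.Binary.PropositionalEquality using (_≡_; refl; sym; cong; cong₂)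

n≤suc-pred : ∀ n → n ≤ suc (pred n)
n≤suc-pred zero    = z≤n
n≤suc-pred (suc n) = ≤-refl

pred-≤ : ∀ n → pred n ≤ n
pred-≤ zero    = z≤n
pred-≤ (suc n) = n≤1+n n

size≤buffer : ∀ v s → size v s ≤ buffer s
size≤buffer one   (st a b _ _) = m≤m+n a b
size≤buffer alpha (st a b _ _) = m≤n+m b a

buffer-accept : ∀ v s → buffer (step s (arrive v) accept) ≡ suc (buffer s)
buffer-accept one   (st a b _ _) = refl
buffer-accept alpha (st a b _ _) = +-suc a b

step-reject : ∀ v s → step s (arrive v) reject ≡ s
step-reject one   s = refl
step-reject alpha s = refl

buffer-sendFrom : ∀ v s → 0 < size v s → suc (buffer (step s send (sendFrom v))) ≡ buffer s
buffer-sendFrom one   (st (suc a) b _ _) _ = refl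
buffer-sendFrom alpha (st a (suc b) _ _) _ = sym (+-suc a b)

buffer-send-≤ : ∀ s d → buffer s ≤ suc (buffer (step s send d))
buffer-send-≤ (st a b _ _) (sendFrom one)   = +-monoˡ-≤ b (n≤suc-pred a)
buffer-send-≤ (st a b _ _) (sendFrom alpha) =
  ≤-trans (+-monoʳ-≤ a (n≤suc-pred b)) (≤-reflexive (+-suc a (pred b)))
buffer-send-≤ s accept = n≤1+n (buffer s)
buffer-send-≤ s reject = n≤1+n (buffer s)
buffer-send-≤ s idle   = n≤1+n (buffer s)

size-send-≤ : ∀ v s d → size v (step s send d) ≤ size v s
size-send-≤ one   (st a b _ _) (sendFrom one)   = pred-≤ a
size-send-≤ alpha (st a b _ _) (sendFrom one)   = ≤-refl
size-send-≤ one   (st a b _ _) (sendFrom alpha) = ≤-refl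
size-send-≤ alpha (st a b _ _) (sendFrom alpha) = pred-≤ b
size-send-≤ v s accept = ≤-refl
size-send-≤ v s reject = ≤-refl
size-send-≤ v s idle   = ≤-refl

Within : ℕ → State → Set
Within B s = ∀ v → size v s ≤ B

buffer≤2B : ∀ {B s} → Within B s → buffer s ≤ B + B
buffer≤2B w = +-mono-≤ (w one) (w alpha)

within-s0 : ∀ B → Within B s0
within-s0 B one   = z≤n
within-s0 B alpha = z≤n

within-step : ∀ {B s e d} → DiligentStep B s e d → Within B s → Within B (step s e d)
within-step {s = s} (rej {v} _) w u rewrite step-reject v s = w u
within-step (acc {one}   p) w one   = p
within-step (acc {one}   p) w alpha = w alpha
within-step (acc {alpha} p) w one   = w one
within-step (acc {alpha} p) w alpha = p
within-step {s = s} {d = d} (snd _) w u = ≤-trans (size-send-≤ u s d) (w u)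
within-step (idl _ _) w u = w u

buffer-opt-arrive : ∀ {B s v d} → DiligentStep B s (arrive v) d →
                    buffer (step s (arrive v) d) ≤ suc (buffer s)
buffer-opt-arrive {s = s} (acc {v} _) = ≤-reflexive (buffer-accept v s)
buffer-opt-arrive {s = s} (rej {v} _) rewrite step-reject v s = n≤1+n (buffer s)

buffer-greedy-arrive : ∀ B v s →
  buffer (step s (arrive v) (greedyDec B s (arrive v))) ≡ suc (buffer s)
  ⊎ B ≤ buffer (step s (arrive v) (greedyDec B s (arrive v)))
buffer-greedy-arrive B v s with size v s <? B
... | yes _ = inj₁ (buffer-accept v s)
... | no  full rewrite step-reject v s = inj₂ (≤-trans (≮⇒≥ full) (size≤buffer v s))

record Gap (B : ℕ) (so sg : State) : Set where
  field
    within : Within B so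
    gap    : buffer so ≤ buffer sg + B
open Gap

gap-after-arrival : ∀ {B m m′ n n′} → m′ ≤ B + B → m′ ≤ suc m → m ≤ n + B →
                    n′ ≡ suc n ⊎ B ≤ n′ → m′ ≤ n′ + B
gap-after-arrival {B} {m} {m′} {n} {n′} _ grow le (inj₁ accepted) = begin
  m′           ≤⟨ grow ⟩
  suc m        ≤⟨ s≤s le ⟩
  suc (n + B)  ≡⟨ cong (_+ B) (sym accepted) ⟩
  n′ + B       ∎
  where open ≤-Reasoning
gap-after-arrival {B} bounded _ _ (inj₂ full) = ≤-trans bounded (+-monoˡ-≤ B full)

gap-arrive : ∀ {B so sg v d} → DiligentStep B so (arrive v) d → Gap B so sg →
             buffer (step so (arrive v) d) ≤ buffer (step sg (arrive v) (greedyDec B sg (arrive v))) + B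
gap-arrive {B} {sg = sg} {v} ds I =
  gap-after-arrival (buffer≤2B (within-step ds (within I))) (buffer-opt-arrive ds) (gap I)
                    (buffer-greedy-arrive B v sg)

gap-step : ∀ {B so sg e d} → DiligentStep B so e d → Gap B so sg →
           buffer (step so e d) ≤ buffer (step sg e (greedyDec B sg e)) + B
gap-step ds@(acc _) I = gap-arrive ds I
gap-step ds@(rej _) I = gap-arrive ds I
gap-step {B} {so} {sg} (snd {v} nonempty) I = s≤s⁻¹ (begin
  suc (buffer (step so send (sendFrom v)))  ≡⟨ buffer-sendFrom v so nonempty ⟩
  buffer so                                 ≤⟨ gap I ⟩
  buffer sg + B                             ≤⟨ +-monoˡ-≤ B (buffer-send-≤ sg (greedyDec B sg send)) ⟩
  suc (buffer (step sg send (greedyDec B sg send))) + B  ∎)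
  where open ≤-Reasoning
gap-step (idl q1≡0 qα≡0) _ = ≤-trans (≤-reflexive (cong₂ _+_ q1≡0 qα≡0)) z≤n

gap-preserved : ∀ {B so sg e d} → DiligentStep B so e d → Gap B so sg →
                Gap B (step so e d) (step sg e (greedyDec B sg e))
gap-preserved ds I = record { within = within-step ds (within I) ; gap = gap-step ds I }

lockstep : ∀ {B} (R : State → State → Set) →
  (∀ {so sg e d} → DiligentStep B so e d → R so sg → R (step so e d) (step sg e (greedyDec B sg e))) →
  ∀ {so sg evs opt} → Diligent B so evs opt → R so sg → ∀ t →
  R (run so (take t evs) (take t opt)) (run sg (take t evs) (take t (greedy B sg evs)))
lockstep R preserve D r zero = r
lockstep R preserve [] r (suc t) = r
lockstep R preserve (ds ∷ D) r (suc t) = lockstep R preserve D (preserve ds r) t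

lemma5 : (α : ℚ) → 1ℚ <ℚ α → (B : ℕ) → (evs : List Event) → (opt : List Decision) →
         Diligent B s0 evs opt → Optimal α B evs opt →
         (t : ℕ) →
         buffer (run s0 (take t evs) (take t opt))
           ≤ buffer (run s0 (take t evs) (take t (greedy B s0 evs))) + B
lemma5 _ _ B _ _ diligent _ t =
  gap (lockstep (Gap B) gap-preserved diligent (record { within = within-s0 B ; gap = z≤n }) t)
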